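{- There is an absolute constant $c>0$ such that for every integer $m\ge 2$ the following holds. There exist a set $\mathcal{X}\subseteq\mathbb{R}$ of $n=4m-3$ points, the number of clusters $k=2m-1$, and an initial clustering of $\mathcal{X}$ into $k$ clusters, such that some execution of the Hartigan--Wong method on $\mathcal{X}$ starting from this clustering performs at least $2^{cn}$ iterations before reaching a local optimum. In other words, the Hartigan--Wong method can take $2^{\Omega(n)}$ iterations to converge, even on instances of $k$-means clustering on the line.
   Context: For a finite nonempty set $S\subseteq\mathbb{R}^d$ let $\operatorname{cm}(S)=\frac{1}{|S|}\sum_{x\in S}x$. Given a finite set $\mathcal{X}\subseteq\mathbb{R}^d$ and an integer $k$, a clustering is a partition $C=(C_1,\dots,C_k)$ of $\mathcal{X}$ into $k$ labeled nonempty clusters, and its cost ($k$-means objective) is $\Phi(C)=\sum_{i=1}^k\sum_{x\in C_i}\|x-\operatorname{cm}(C_i)\|^2$ (with the convention that an empty cluster contributes $0$). The Hartigan--Wong method starts from an arbitrary clustering and repeatedly performs an iteration: choose a point $x\in C_i$ and an index $j\ne i$ such that moving $x$ from $C_i$ to $C_j$ strictly decreases $\Phi$, and perform this move. Any such choice may be made (the choice of point and target cluster is arbitrary among improving moves). The method terminates when no improving move exists; the clustering is then a local optimum. The running time is the number of iterations. -}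

module Defs where

open import Data.Nat as ℕ using (ℕ; zero; suc)
open import Data.Bool using (Bool; true; false; if_then_else_)
open import Data.Fin using (Fin; _≟_)
open import Data.Integer using (+_)
open import Data.Rational using (ℚ; 0ℚ; _+_; _*_; _-_; _<_; _/_)
open import Data.Product using (Σ; _×_)
open import Relation.Nullary using (¬_; does)
open import Relation.Binary.PropositionalEquality using (_≡_; _≢_)

Clustering : ℕ → ℕ → Set
Clustering n k = Fin n → Fin k

Nonempty : ∀ {n k} → Clustering n k → Set
Nonempty {n} {k} a = ∀ (i : Fin k) → Σ (Fin n) λ p → a p ≡ i

sumFin : ∀ {n} → (Fin n → ℚ) → ℚ
sumFin {zero}  f = 0ℚ
sumFin {suc n} f = f Data.Fin.zero + sumFin {n} (λ i → f (Data.Fin.suc i))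

countFin : ∀ {n} → (Fin n → Bool) → ℕ
countFin {zero}  f = zero
countFin {suc n} f = (if f Data.Fin.zero then 1 else 0) ℕ.+ countFin {n} (λ i → f (Data.Fin.suc i))

-- s / c, with the convention 0 when c = 0 (empty cluster)
divByCount : ℚ → ℕ → ℚ
divByCount s zero    = 0ℚ
divByCount s (suc c) = s * ((+ 1) / suc c)

inCluster : ∀ {n k} → Clustering n k → Fin k → Fin n → Bool
inCluster a i p = does (a p ≟ i)

-- centre of mass cm(C_i) of cluster i (0 if empty; never used then)
cm : ∀ {n k} → (Fin n → ℚ) → Clustering n k → Fin k → ℚ
cm X a i = divByCount (sumFin (λ p → if inCluster a i p then X p else 0ℚ))
                      (countFin (inCluster a i))

sq : ℚ → ℚ
sq x = x * x

-- k-means cost Φ(C) = Σ_i Σ_{x ∈ C_i} (x - cm(C_i))^2, written as a sum over points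
Φ : ∀ {n k} → (Fin n → ℚ) → Clustering n k → ℚ
Φ X a = sumFin (λ p → sq (X p - cm X a (a p)))

move : ∀ {n k} → Clustering n k → Fin n → Fin k → Clustering n k
move a p j q = if does (q ≟ p) then j else a q

HWStep : ∀ {n k} → (Fin n → ℚ) → Clustering n k → Clustering n k → Set
HWStep {n} {k} X a b =
  Σ (Fin n) λ p → Σ (Fin k) λ j →
    (j ≢ a p) × (∀ q → b q ≡ move a p j q) × (Φ X b < Φ X a)

LocalOpt : ∀ {n k} → (Fin n → ℚ) → Clustering n k → Set
LocalOpt {n} {k} X a = ∀ (p : Fin n) (j : Fin k) → j ≢ a p → ¬ (Φ X (move a p j) < Φ X a)

-- The points form ℓ = m - 1 nested levels, level d being a copy of one gadget scaled by (-8)^d.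
-- A level has a hub cluster, a side cluster and two movable points: its x-point moves between its
-- hub and the hub of the next level, its y-point between its hub and its side cluster. Thanks to
-- the scaling, whether such a move lowers the k-means cost depends only on the level and its two
-- neighbours, and a finite computation shows that it does exactly when the switches of the level
-- are out of step with the parity of the level inside it. The levels therefore form a binary
-- counter: a round on levels 0..j toggles x at level j, runs a round on levels 0..j-1, toggles y
-- at level j and runs another round, so it takes at least 2^(j+1) improving moves. Hartigan–Wong
-- then continues to a local optimum, because every improving move decreases the number of
-- clusterings cheaper than the current one. With n = 4ℓ + 1 points and T ≥ 2^ℓ moves, 2^n ≤ T^5.

module Submission where

open import Defs

open import Data.Bool using (Bool; true; false; if_then_else_; not; T; _xor_)
open import Data.Bool.Properties using (not-involutive; not-distribˡ-xor; not-distribʳ-xor)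
open import Data.Empty using (⊥-elim)
open import Data.Fin using (Fin; zero; suc; _≟_; finToFun; funToFin)
open import Data.Fin.Patterns using (0F; 1F; 2F; 3F)
open import Data.Fin.Properties using (any?; finToFun-funToFin; suc-injective)
open import Data.List using (List; []; _∷_; _++_; map; length)
open import Data.List.Properties using (map-id; length-map)
open import Data.Maybe using (Maybe; just; nothing)
open import Data.Nat as ℕ using (ℕ; zero; suc; z≤n; s≤s; _∸_; _^_)
open import Data.Nat.Induction using (<-wellFounded)
import Data.Nat.Properties as ℕ
open import Data.Product using (Σ; ∃; _×_; _,_; proj₁; proj₂)
open import Data.Rational using (ℚ; 0ℚ; 1ℚ; _+_; _*_; _-_; -_; _<_; _≤_; _÷_; normalize)
open import Data.Rational.Properties
  using (+-0-commutativeMonoid; +-assoc; +-comm; +-identityˡ; +-identityʳ; +-monoˡ-<;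
         *-assoc; *-zeroʳ; *-identityʳ; *-distribˡ-+; *-monoʳ-<-pos; *-monoˡ-≤-nonNeg; *-cancelˡ-≤-neg;
         _<?_; _≤?_; <-irrefl; <-trans; <-≤-trans; ≤-trans; ≤-antisym; ≤-reflexive)
open import Data.Rational.Solver using (module +-*-Solver)
open import Data.Sum using (inj₁; inj₂)
open import Data.Unit using (⊤; tt)
open import Data.Vec using (Vec; []; _∷_; replicate)
open import Function using (_∘_; id)
open import Function.Definitions using (Injective)
open import Induction.WellFounded using (Acc; acc)
open import Relation.Binary.PropositionalEquality
open import Relation.Nullary using (¬_; does; isYes; yes; no; Dec; ¬?; _×-dec_)
open import Relation.Nullary.Decidable using (True; toWitness; fromWitness; dec-false)

open import Algebra.Properties.CommutativeMonoid.Sum +-0-commutativeMonoid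
  using (sum; sum-cong-≗; sum-replicate-zero; ∑-distrib-+; ∑-comm)

-- Finite sums

sumFin≡sum : ∀ {n} (f : Fin n → ℚ) → sumFin f ≡ sum f
sumFin≡sum {zero}  f = refl
sumFin≡sum {suc n} f = cong (f zero +_) (sumFin≡sum (f ∘ suc))

sum-indicator : ∀ {k} (i : Fin k) (h : Fin k → ℚ) →
  sum (λ c → if does (i ≟ c) then h c else 0ℚ) ≡ h i
sum-indicator {suc k} zero    h = trans (cong (h zero +_) (sum-replicate-zero k)) (+-identityʳ _)
sum-indicator         (suc i) h = trans (+-identityˡ _) (sum-indicator i (h ∘ suc))

except : ∀ {k} → Fin k → (Fin k → ℚ) → Fin k → ℚ
except i f c = if does (i ≟ c) then 0ℚ else f c

sum-pull : ∀ {k} (i : Fin k) (f : Fin k → ℚ) → sum f ≡ f i + sum (except i f)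
sum-pull i f = begin
  sum f                                                          ≡⟨ sum-cong-≗ split ⟩
  sum (λ c → (if does (i ≟ c) then f c else 0ℚ) + except i f c)  ≡⟨ ∑-distrib-+ _ (except i f) ⟩
  sum (λ c → if does (i ≟ c) then f c else 0ℚ) + sum (except i f)
    ≡⟨ cong (_+ sum (except i f)) (sum-indicator i f) ⟩
  f i + sum (except i f)                                         ∎
  where
  open ≡-Reasoning
  split : ∀ c → f c ≡ (if does (i ≟ c) then f c else 0ℚ) + (if does (i ≟ c) then 0ℚ else f c)
  split c with does (i ≟ c)
  ... | true  = sym (+-identityʳ _)
  ... | false = sym (+-identityˡ _)

sum-<-at-two : ∀ {k} {f g : Fin k → ℚ} (i j : Fin k) → i ≢ j →
  (∀ c → c ≢ i → c ≢ j → f c ≡ g c) → f i + f j < g i + g j → sum f < sum g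
sum-<-at-two {f = f} {g} i j i≢j same lt =
  subst₂ _<_ (sym (pull₂ f)) (sym (pull₂ g))
    (subst (λ r → (f i + f j) + sum (rest f) < (g i + g j) + r) (sum-cong-≗ rest-same)
      (+-monoˡ-< (sum (rest f)) lt))
  where
  rest : (Fin _ → ℚ) → Fin _ → ℚ
  rest h = except j (except i h)
  pull₂ : ∀ h → sum h ≡ (h i + h j) + sum (rest h)
  pull₂ h = begin
    sum h                                          ≡⟨ sum-pull i h ⟩
    h i + sum (except i h)                         ≡⟨ cong (h i +_) (sum-pull j (except i h)) ⟩
    h i + (except i h j + sum (rest h))            ≡⟨ cong (λ x → h i + (x + sum (rest h))) except-j ⟩
    h i + (h j + sum (rest h))                     ≡⟨ +-assoc (h i) (h j) _ ⟨
    (h i + h j) + sum (rest h)                     ∎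
    where
    open ≡-Reasoning
    except-j : except i h j ≡ h j
    except-j with i ≟ j
    ... | yes i≡j = ⊥-elim (i≢j i≡j)
    ... | no  _   = refl
  rest-same : ∀ c → rest f c ≡ rest g c
  rest-same c with j ≟ c | i ≟ c
  ... | yes _   | _       = refl
  ... | no  _   | yes _   = refl
  ... | no  j≢c | no  i≢c = same c (i≢c ∘ sym) (j≢c ∘ sym)

-- Cluster costs

listSum : List ℚ → ℚ
listSum []       = 0ℚ
listSum (x ∷ xs) = x + listSum xs

mean : List ℚ → ℚ
mean xs = divByCount (listSum xs) (length xs)

listCost : List ℚ → ℚ
listCost xs = listSum (map (λ v → sq (v - mean xs)) xs)

members : ∀ {n k} → Clustering n k → (Fin n → ℚ) → Fin k → List ℚ
members {zero}  a X c = []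
members {suc n} a X c =
  if inCluster a c zero then X zero ∷ members (a ∘ suc) (X ∘ suc) c else members (a ∘ suc) (X ∘ suc) c

clusterCost : ∀ {n k} → (Fin n → ℚ) → Clustering n k → Fin k → ℚ
clusterCost X a c = sum (λ q → if inCluster a c q then sq (X q - cm X a c) else 0ℚ)

sum-members : ∀ {n k} (a : Clustering n k) (X : Fin n → ℚ) c (φ : ℚ → ℚ) →
  sum (λ q → if inCluster a c q then φ (X q) else 0ℚ) ≡ listSum (map φ (members a X c))
sum-members {zero}  a X c φ = refl
sum-members {suc n} a X c φ with inCluster a c zero
... | true  = cong (φ (X zero) +_) (sum-members (a ∘ suc) (X ∘ suc) c φ)
... | false = trans (+-identityˡ _) (sum-members (a ∘ suc) (X ∘ suc) c φ)

countFin-members : ∀ {n k} (a : Clustering n k) (X : Fin n → ℚ) c →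
  countFin (inCluster a c) ≡ length (members a X c)
countFin-members {zero}  a X c = refl
countFin-members {suc n} a X c with inCluster a c zero
... | true  = cong suc (countFin-members (a ∘ suc) (X ∘ suc) c)
... | false = countFin-members (a ∘ suc) (X ∘ suc) c

module _ {n k : ℕ} (X : Fin n → ℚ) (a : Clustering n k) where

  cm≡mean-members : ∀ c → cm X a c ≡ mean (members a X c)
  cm≡mean-members c = cong₂ divByCount sum-inside (countFin-members a X c)
    where
    open ≡-Reasoning
    inside : Fin n → ℚ
    inside q = if inCluster a c q then X q else 0ℚ
    sum-inside : sumFin inside ≡ listSum (members a X c)
    sum-inside = begin
      sumFin inside                     ≡⟨ sumFin≡sum inside ⟩
      sum inside                        ≡⟨ sum-members a X c id ⟩
      listSum (map id (members a X c))  ≡⟨ cong listSum (map-id (members a X c)) ⟩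
      listSum (members a X c)           ∎

  clusterCost≡listCost : ∀ c → clusterCost X a c ≡ listCost (members a X c)
  clusterCost≡listCost c = trans (sum-members a X c (λ v → sq (v - cm X a c)))
    (cong (λ μ → listSum (map (λ v → sq (v - μ)) (members a X c))) (cm≡mean-members c))

  Φ≡sum-clusterCost : Φ X a ≡ sum (clusterCost X a)
  Φ≡sum-clusterCost = begin
    Φ X a                                ≡⟨ sumFin≡sum (λ q → sq (X q - cm X a (a q))) ⟩
    sum (λ q → sq (X q - cm X a (a q)))  ≡⟨ sum-cong-≗ (λ q → sym (sum-indicator (a q) (λ c → sq (X q - cm X a c)))) ⟩
    sum (λ q → sum (term q))             ≡⟨ ∑-comm term ⟩
    sum (clusterCost X a)                ∎
    where
    open ≡-Reasoning
    term : Fin n → Fin k → ℚ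
    term q c = if inCluster a c q then sq (X q - cm X a c) else 0ℚ

members-cong : ∀ {n k} (X : Fin n → ℚ) (a b : Clustering n k) c →
  (∀ q → inCluster a c q ≡ inCluster b c q) → members a X c ≡ members b X c
members-cong {zero}  X a b c same = refl
members-cong {suc n} X a b c same =
  cong₂ (λ here rest → if here then X zero ∷ rest else rest) (same zero)
    (members-cong (X ∘ suc) (a ∘ suc) (b ∘ suc) c (same ∘ suc))

members-suc : ∀ {n k} (a : Clustering n k) (X : Fin n → ℚ) c →
  members (λ q → suc (a q)) X (suc c) ≡ members a X c
members-suc {zero}  a X c = refl
members-suc {suc n} a X c =
  cong (λ rest → if inCluster a c zero then X zero ∷ rest else rest) (members-suc (a ∘ suc) (X ∘ suc) c)

members-suc-zero : ∀ {n k} (a : Clustering n k) (X : Fin n → ℚ) → members (λ q → suc (a q)) X zero ≡ []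
members-suc-zero {zero}  a X = refl
members-suc-zero {suc n} a X = members-suc-zero (a ∘ suc) (X ∘ suc)

members-scale : ∀ {n k} (a : Clustering n k) (X : Fin n → ℚ) r c →
  members a (λ q → r * X q) c ≡ map (r *_) (members a X c)
members-scale {zero}  a X r c = refl
members-scale {suc n} a X r c with inCluster a c zero
... | true  = cong (r * X zero ∷_) (members-scale (a ∘ suc) (X ∘ suc) r c)
... | false = members-scale (a ∘ suc) (X ∘ suc) r c

clusterCost-cong : ∀ {n k} (X : Fin n → ℚ) (a b : Clustering n k) c →
  (∀ q → inCluster a c q ≡ inCluster b c q) → clusterCost X a c ≡ clusterCost X b c
clusterCost-cong X a b c same = begin
  clusterCost X a c          ≡⟨ clusterCost≡listCost X a c ⟩
  listCost (members a X c)   ≡⟨ cong listCost (members-cong X a b c same) ⟩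
  listCost (members b X c)   ≡⟨ clusterCost≡listCost X b c ⟨
  clusterCost X b c          ∎
  where open ≡-Reasoning

Φ-cong : ∀ {n k} (X : Fin n → ℚ) (a b : Clustering n k) → (∀ q → a q ≡ b q) → Φ X a ≡ Φ X b
Φ-cong X a b a≗b = begin
  Φ X a                  ≡⟨ Φ≡sum-clusterCost X a ⟩
  sum (clusterCost X a)  ≡⟨ sum-cong-≗ (λ c → clusterCost-cong X a b c (λ q → cong (λ i → does (i ≟ c)) (a≗b q))) ⟩
  sum (clusterCost X b)  ≡⟨ Φ≡sum-clusterCost X b ⟨
  Φ X b                  ∎
  where open ≡-Reasoning

Φ-<-single-move : ∀ {n k} (X : Fin n → ℚ) (a b : Clustering n k) (p : Fin n) →
  b p ≢ a p → (∀ q → q ≢ p → b q ≡ a q) →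
  clusterCost X b (a p) + clusterCost X b (b p) < clusterCost X a (a p) + clusterCost X a (b p) →
  Φ X b < Φ X a
Φ-<-single-move X a b p moved others lt =
  subst₂ _<_ (sym (Φ≡sum-clusterCost X b)) (sym (Φ≡sum-clusterCost X a))
    (sum-<-at-two (a p) (b p) (moved ∘ sym) unchanged lt)
  where
  unchanged : ∀ c → c ≢ a p → c ≢ b p → clusterCost X b c ≡ clusterCost X a c
  unchanged c c≢old c≢new = clusterCost-cong X b a c same
    where
    same : ∀ q → inCluster b c q ≡ inCluster a c q
    same q with q ≟ p
    ... | yes refl = trans (dec-false (b q ≟ c) (c≢new ∘ sym)) (sym (dec-false (a q ≟ c) (c≢old ∘ sym)))
    ... | no  q≢p  = cong (λ i → does (i ≟ c)) (others q q≢p)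

hwStep-single-move : ∀ {n k} (X : Fin n → ℚ) (a b : Clustering n k) (p : Fin n) →
  b p ≢ a p → (∀ q → q ≢ p → b q ≡ a q) →
  clusterCost X b (a p) + clusterCost X b (b p) < clusterCost X a (a p) + clusterCost X a (b p) →
  HWStep X a b
hwStep-single-move X a b p moved others lt =
  p , b p , moved , is-move , Φ-<-single-move X a b p moved others lt
  where
  is-move : ∀ q → b q ≡ move a p (b p) q
  is-move q with q ≟ p
  ... | yes refl = refl
  ... | no  q≢p  = others q q≢p

-- Scaling a cluster

listSum-scale : ∀ r xs → listSum (map (r *_) xs) ≡ r * listSum xs
listSum-scale r []       = sym (*-zeroʳ r)
listSum-scale r (x ∷ xs) = trans (cong (r * x +_) (listSum-scale r xs)) (sym (*-distribˡ-+ r x (listSum xs)))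

divByCount-scale : ∀ r s c → divByCount (r * s) c ≡ r * divByCount s c
divByCount-scale r s zero    = sym (*-zeroʳ r)
divByCount-scale r s (suc c) = *-assoc r s _

mean-scale : ∀ r xs → mean (map (r *_) xs) ≡ r * mean xs
mean-scale r xs = trans (cong₂ divByCount (listSum-scale r xs) (length-map (r *_) xs))
                        (divByCount-scale r (listSum xs) (length xs))

sq-scale : ∀ r v μ → sq (r * v - r * μ) ≡ (r * r) * sq (v - μ)
sq-scale = solve 3 (λ r v μ → (r :* v :- r :* μ) :* (r :* v :- r :* μ) := (r :* r) :* ((v :- μ) :* (v :- μ))) refl
  where open +-*-Solver

listCost-scale : ∀ r xs → listCost (map (r *_) xs) ≡ (r * r) * listCost xs
listCost-scale r xs = trans (cong (λ μ → deviation μ (map (r *_) xs)) (mean-scale r xs)) (deviation-scale xs)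
  where
  deviation : ℚ → List ℚ → ℚ
  deviation μ ys = listSum (map (λ v → sq (v - μ)) ys)
  deviation-scale : ∀ ys → deviation (r * mean xs) (map (r *_) ys) ≡ (r * r) * deviation (mean xs) ys
  deviation-scale []       = sym (*-zeroʳ (r * r))
  deviation-scale (y ∷ ys) = trans (cong₂ _+_ (sq-scale r y (mean xs)) (deviation-scale ys))
                                   (sym (*-distribˡ-+ (r * r) _ _))

-- Executions and termination

data Execution {n k} (X : Fin n → ℚ) : Clustering n k → Clustering n k → ℕ → Set where
  []  : ∀ {a} → Execution X a a 0
  _∷_ : ∀ {a b c T} → HWStep X a b → Execution X b c T → Execution X a c (suc T)

_++ₑ_ : ∀ {n k} {X : Fin n → ℚ} {a b c : Clustering n k} {T₁ T₂} →
  Execution X a b T₁ → Execution X b c T₂ → Execution X a c (T₁ ℕ.+ T₂)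
[]      ++ₑ e₂ = e₂
(s ∷ e₁) ++ₑ e₂ = s ∷ (e₁ ++ₑ e₂)

execution⇒run : ∀ {n k} {X : Fin n → ℚ} {a c : Clustering n k} {T} → Execution X a c T →
  Σ (ℕ → Clustering n k) λ run →
    run 0 ≡ a × run T ≡ c × (∀ t → t ℕ.< T → HWStep X (run t) (run (suc t)))
execution⇒run {a = a} [] = (λ _ → a) , refl , refl , λ _ ()
execution⇒run {X = X} {a = a} (s ∷ e) with execution⇒run e
... | run , refl , end , steps = run′ , refl , end , steps′
  where
  run′ : ℕ → _
  run′ zero    = a
  run′ (suc t) = run t
  steps′ : ∀ t → t ℕ.< _ → HWStep X (run′ t) (run′ (suc t))
  steps′ zero    _         = s
  steps′ (suc t) (s≤s t<T) = steps t t<T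

indicator : Bool → ℕ
indicator b = if b then 1 else 0

indicator-mono : ∀ {b b′} → (T b → T b′) → indicator b ℕ.≤ indicator b′
indicator-mono {false}         _ = z≤n
indicator-mono {true} {true}   _ = ℕ.≤-refl
indicator-mono {true} {false}  h = ⊥-elim (h _)

indicator-< : ∀ {b b′} → ¬ T b → T b′ → indicator b ℕ.< indicator b′
indicator-< {false} {true} _ _ = ℕ.≤-refl
indicator-< {true}         ¬b _ = ⊥-elim (¬b _)

countFin-mono : ∀ {n} {f g : Fin n → Bool} → (∀ i → T (f i) → T (g i)) → countFin f ℕ.≤ countFin g
countFin-mono {zero}  f⇒g = z≤n
countFin-mono {suc n} f⇒g = ℕ.+-mono-≤ (indicator-mono (f⇒g zero)) (countFin-mono (f⇒g ∘ suc))

countFin-mono-< : ∀ {n} {f g : Fin n → Bool} → (∀ i → T (f i) → T (g i)) →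
  ∀ i → ¬ T (f i) → T (g i) → countFin f ℕ.< countFin g
countFin-mono-< f⇒g zero    ¬fi gi = ℕ.+-mono-<-≤ (indicator-< ¬fi gi) (countFin-mono (f⇒g ∘ suc))
countFin-mono-< f⇒g (suc i) ¬fi gi =
  ℕ.+-mono-≤-< (indicator-mono (f⇒g zero)) (countFin-mono-< (f⇒g ∘ suc) i ¬fi gi)

module _ {n k : ℕ} (X : Fin n → ℚ) where

  enumerated : Fin (k ℕ.^ n) → Clustering n k
  enumerated = finToFun

  cheaperThan : ℚ → Fin (k ℕ.^ n) → Bool
  cheaperThan v i = isYes (Φ X (enumerated i) <? v)

  cheaper : ℚ → ℕ
  cheaper v = countFin (cheaperThan v)

  cheaper-< : ∀ (a b : Clustering n k) → Φ X b < Φ X a → cheaper (Φ X b) ℕ.< cheaper (Φ X a)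
  cheaper-< a b b<a =
    countFin-mono-< {f = cheaperThan (Φ X b)} {g = cheaperThan (Φ X a)} below-trans (funToFin b) not-below below
    where
    code : Φ X (enumerated (funToFin b)) ≡ Φ X b
    code = Φ-cong X _ b (finToFun-funToFin b)
    below-trans : ∀ i → T (cheaperThan (Φ X b) i) → T (cheaperThan (Φ X a) i)
    below-trans i lt = fromWitness (<-trans (toWitness {a? = Φ X (enumerated i) <? Φ X b} lt) b<a)
    not-below : ¬ T (cheaperThan (Φ X b) (funToFin b))
    not-below lt = <-irrefl code (toWitness {a? = Φ X (enumerated (funToFin b)) <? Φ X b} lt)
    below : T (cheaperThan (Φ X a) (funToFin b))
    below = fromWitness (subst (_< Φ X a) (sym code) b<a)

  improving? : (a : Clustering n k) → Dec (∃ λ p → ∃ λ j → j ≢ a p × Φ X (move a p j) < Φ X a)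
  improving? a = any? λ p → any? λ j → ¬? (j ≟ a p) ×-dec (Φ X (move a p j) <? Φ X a)

  hartiganWong-terminates : (a : Clustering n k) → ∃ λ T → ∃ λ c → Execution X a c T × LocalOpt X c
  hartiganWong-terminates a = go a (<-wellFounded (cheaper (Φ X a)))
    where
    go : ∀ a → Acc ℕ._<_ (cheaper (Φ X a)) → ∃ λ T → ∃ λ c → Execution X a c T × LocalOpt X c
    go a (acc rec) with improving? a
    ... | no none = 0 , a , [] , λ p j j≢ap lt → none (p , j , j≢ap , lt)
    ... | yes (p , j , j≢ap , lt) with go (move a p j) (rec (cheaper-< a (move a p j) lt))
    ...   | T , c , e , opt = suc T , c , (p , j , j≢ap , (λ _ → refl) , lt) ∷ e , opt

-- The instance

<-by-computation : (p q : ℚ) → {True (p <? q)} → p < q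
<-by-computation p q {p<q} = toWitness p<q

≤-by-computation : (p q : ℚ) → {True (p ≤? q)} → p ≤ q
≤-by-computation p q {p≤q} = toWitness p≤q

record Switches : Set where
  constructor switches
  field
    xInner : Bool
    yHub   : Bool
open Switches

parity : Switches → Bool
parity s = xInner s xor yHub s

ratio hubPoint sidePoint xPoint yPoint ghost : ℚ
ratio     = - normalize 8 1
hubPoint  = - 1ℚ
sidePoint = normalize 2 1
xPoint    = normalize 6 1
yPoint    = - normalize 6 1
-- the x-point of the enclosing level, at the scale of this one
ghost     = xPoint ÷ ratio

points clusters : ℕ → ℕ
points   L = suc (L ℕ.* 4)
clusters L = suc (L ℕ.* 2)

position : (L : ℕ) → Fin (points L) → ℚ
position zero    0F = hubPoint
position (suc L) 0F = hubPoint
position (suc L) 1F = sidePoint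
position (suc L) 2F = xPoint
position (suc L) 3F = yPoint
position (suc L) (suc (suc (suc (suc p)))) = ratio * position L p

-- cluster 0 is the hub of the outermost level, cluster 1 its side cluster,
-- and cluster 2 + c is cluster c of the next level
clustering : (L : ℕ) → Vec Switches L → Clustering (points L) (clusters L)
clustering zero    []       0F = 0F
clustering (suc L) (s ∷ ss) 0F = 0F
clustering (suc L) (s ∷ ss) 1F = 1F
clustering (suc L) (s ∷ ss) 2F = if xInner s then 2F else 0F
clustering (suc L) (s ∷ ss) 3F = if yHub s then 0F else 1F
clustering (suc L) (s ∷ ss) (suc (suc (suc (suc p)))) = suc (suc (clustering L ss p))

data Switch : Set where
  xSwitch ySwitch : Switch

toggle : Switch → Switches → Switches
toggle xSwitch (switches bx yh) = switches (not bx) yh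
toggle ySwitch (switches bx yh) = switches bx (not yh)

toggleAt : ∀ {L} → Switch → ℕ → Vec Switches L → Vec Switches L
toggleAt w j       []       = []
toggleAt w zero    (s ∷ ss) = toggle w s ∷ ss
toggleAt w (suc j) (s ∷ ss) = s ∷ toggleAt w j ss

first : ∀ {L} → Vec Switches L → Maybe Switches
first []      = nothing
first (s ∷ _) = just s

-- The innermost level behaves as if the level below it had odd parity.
levelParity : Maybe Switches → Bool
levelParity nothing  = true
levelParity (just s) = parity s

at : ∀ {L} → Vec Switches L → ℕ → Switches
at []       _       = switches false false
at (s ∷ _)  zero    = s
at (_ ∷ ss) (suc i) = at ss i

innerParity : ∀ {L} → Vec Switches L → ℕ → Bool
innerParity []       _       = true
innerParity (_ ∷ ss) zero    = levelParity (first ss)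
innerParity (_ ∷ ss) (suc i) = innerParity ss i

-- The condition under which toggling switch w of a level lowers the cost,
-- p being the parity of the level inside it.
EnabledAt : Switch → Switches → Bool → Set
EnabledAt xSwitch s p = xInner s ≡ not p
EnabledAt ySwitch s p = yHub s ≡ not (xInner s)

Enabled : ∀ {L} → Switch → Vec Switches L → ℕ → Set
Enabled w ss j = EnabledAt w (at ss j) (innerParity ss j)

ghostIf : Bool → List ℚ
ghostIf true  = ghost ∷ []
ghostIf false = []

ghosts : ∀ {k} → Bool → Fin k → List ℚ
ghosts g zero    = ghostIf g
ghosts g (suc _) = []

-- g: whether the hub also holds the x-point of the enclosing level, as the ghost
contents : (L : ℕ) → Bool → Vec Switches L → Fin (clusters L) → List ℚ
contents L g ss c = ghosts g c ++ members (clustering L ss) (position L) c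

hubContents : Bool → Maybe Switches → List ℚ
hubContents g nothing  = ghostIf g ++ hubPoint ∷ []
hubContents g (just s) = ghostIf g ++ hubPoint ∷
  (if xInner s then [] else xPoint ∷ []) ++ (if yHub s then yPoint ∷ [] else [])

innerHubContents : Switches → Maybe Switches → List ℚ
innerHubContents s t = map (ratio *_) (hubContents (xInner s) t)

sideContents : Switches → List ℚ
sideContents s = sidePoint ∷ (if yHub s then [] else yPoint ∷ [])

members-inner : ∀ L (ss : Vec Switches L) c →
  members (λ q → suc (suc (clustering L ss q))) (λ q → ratio * position L q) (suc (suc c))
    ≡ map (ratio *_) (members (clustering L ss) (position L) c)
members-inner L ss c = begin
  members (λ q → suc (suc (clustering L ss q))) (λ q → ratio * position L q) (suc (suc c))
    ≡⟨ members-suc (λ q → suc (clustering L ss q)) (λ q → ratio * position L q) (suc c) ⟩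
  members (λ q → suc (clustering L ss q)) (λ q → ratio * position L q) (suc c)
    ≡⟨ members-suc (clustering L ss) (λ q → ratio * position L q) c ⟩
  members (clustering L ss) (λ q → ratio * position L q) c
    ≡⟨ members-scale (clustering L ss) (position L) ratio c ⟩
  map (ratio *_) (members (clustering L ss) (position L) c)
    ∎
  where open ≡-Reasoning

members-inner-hub : ∀ L (ss : Vec Switches L) →
  members (λ q → suc (suc (clustering L ss q))) (λ q → ratio * position L q) zero ≡ []
members-inner-hub L ss = members-suc-zero (λ q → suc (clustering L ss q)) (λ q → ratio * position L q)

members-inner-side : ∀ L (ss : Vec Switches L) →
  members (λ q → suc (suc (clustering L ss q))) (λ q → ratio * position L q) 1F ≡ []
members-inner-side L ss =
  trans (members-suc (λ q → suc (clustering L ss q)) (λ q → ratio * position L q) zero)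
        (members-suc-zero (clustering L ss) (λ q → ratio * position L q))

contents-false : ∀ L (ss : Vec Switches L) c → contents L false ss c ≡ members (clustering L ss) (position L) c
contents-false L ss zero    = refl
contents-false L ss (suc c) = refl

clusterCost≡listCost-contents : ∀ L (ss : Vec Switches L) c →
  clusterCost (position L) (clustering L ss) c ≡ listCost (contents L false ss c)
clusterCost≡listCost-contents L ss c =
  trans (clusterCost≡listCost (position L) (clustering L ss) c) (cong listCost (sym (contents-false L ss c)))

contents-hub : ∀ L g (ss : Vec Switches L) → contents L g ss zero ≡ hubContents g (first ss)
contents-hub zero    g [] = refl
contents-hub (suc L) g (switches false false ∷ ss) =
  cong (λ r → ghostIf g ++ hubPoint ∷ xPoint ∷ r) (members-inner-hub L ss)
contents-hub (suc L) g (switches false true  ∷ ss) =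
  cong (λ r → ghostIf g ++ hubPoint ∷ xPoint ∷ yPoint ∷ r) (members-inner-hub L ss)
contents-hub (suc L) g (switches true  false ∷ ss) =
  cong (λ r → ghostIf g ++ hubPoint ∷ r) (members-inner-hub L ss)
contents-hub (suc L) g (switches true  true  ∷ ss) =
  cong (λ r → ghostIf g ++ hubPoint ∷ yPoint ∷ r) (members-inner-hub L ss)

contents-side : ∀ L g s (ss : Vec Switches L) → contents (suc L) g (s ∷ ss) 1F ≡ sideContents s
contents-side L g (switches false false) ss = cong (λ r → sidePoint ∷ yPoint ∷ r) (members-inner-side L ss)
contents-side L g (switches false true)  ss = cong (sidePoint ∷_) (members-inner-side L ss)
contents-side L g (switches true  false) ss = cong (λ r → sidePoint ∷ yPoint ∷ r) (members-inner-side L ss)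
contents-side L g (switches true  true)  ss = cong (sidePoint ∷_) (members-inner-side L ss)

-- An x-point in the inner hub is the next level's ghost: ratio * ghost = xPoint.
contents-inner : ∀ L g s (ss : Vec Switches L) c →
  contents (suc L) g (s ∷ ss) (suc (suc c)) ≡ map (ratio *_) (contents L (xInner s) ss c)
contents-inner L g (switches false false) ss zero    = members-inner L ss zero
contents-inner L g (switches false true)  ss zero    = members-inner L ss zero
contents-inner L g (switches true  false) ss zero    = cong (xPoint ∷_) (members-inner L ss zero)
contents-inner L g (switches true  true)  ss zero    = cong (xPoint ∷_) (members-inner L ss zero)
contents-inner L g (switches false false) ss (suc c) = members-inner L ss (suc c)
contents-inner L g (switches false true)  ss (suc c) = members-inner L ss (suc c)
contents-inner L g (switches true  false) ss (suc c) = members-inner L ss (suc c)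
contents-inner L g (switches true  true)  ss (suc c) = members-inner L ss (suc c)

contents-innerHub : ∀ L g s (ss : Vec Switches L) → contents (suc L) g (s ∷ ss) 2F ≡ innerHubContents s (first ss)
contents-innerHub L g s ss = trans (contents-inner L g s ss zero) (cong (map (ratio *_)) (contents-hub L (xInner s) ss))

pairCost : List ℚ → List ℚ → ℚ
pairCost xs ys = listCost xs + listCost ys

pairCost-<-comm : ∀ xs ys zs ws → pairCost xs ys < pairCost zs ws → pairCost ys xs < pairCost ws zs
pairCost-<-comm xs ys zs ws =
  subst₂ _<_ (+-comm (listCost xs) (listCost ys)) (+-comm (listCost zs) (listCost ws))

pairCost-scale : ∀ r xs ys → pairCost (map (r *_) xs) (map (r *_) ys) ≡ (r * r) * pairCost xs ys
pairCost-scale r xs ys =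
  trans (cong₂ _+_ (listCost-scale r xs) (listCost-scale r ys)) (sym (*-distribˡ-+ (r * r) _ _))

-- g and t stand for the neighbouring levels: g for the ghost of the enclosing one, t for the switches
-- of the inner one (nothing at the innermost level).
x-toggle-improves-locally : ∀ g bx yh t → let s = switches bx yh in EnabledAt xSwitch s (levelParity t) →
  pairCost (hubContents g (just (toggle xSwitch s))) (innerHubContents (toggle xSwitch s) t)
    < pairCost (hubContents g (just s)) (innerHubContents s t)
x-toggle-improves-locally false _ false nothing                        refl = <-by-computation _ _
x-toggle-improves-locally false _ false (just (switches false false)) refl = <-by-computation _ _
x-toggle-improves-locally false _ false (just (switches false true))  refl = <-by-computation _ _
x-toggle-improves-locally false _ false (just (switches true  false)) refl = <-by-computation _ _
x-toggle-improves-locally false _ false (just (switches true  true))  refl = <-by-computation _ _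
x-toggle-improves-locally false _ true  nothing                        refl = <-by-computation _ _
x-toggle-improves-locally false _ true  (just (switches false false)) refl = <-by-computation _ _
x-toggle-improves-locally false _ true  (just (switches false true))  refl = <-by-computation _ _
x-toggle-improves-locally false _ true  (just (switches true  false)) refl = <-by-computation _ _
x-toggle-improves-locally false _ true  (just (switches true  true))  refl = <-by-computation _ _
x-toggle-improves-locally true  _ false nothing                        refl = <-by-computation _ _
x-toggle-improves-locally true  _ false (just (switches false false)) refl = <-by-computation _ _
x-toggle-improves-locally true  _ false (just (switches false true))  refl = <-by-computation _ _
x-toggle-improves-locally true  _ false (just (switches true  false)) refl = <-by-computation _ _
x-toggle-improves-locally true  _ false (just (switches true  true))  refl = <-by-computation _ _
x-toggle-improves-locally true  _ true  nothing                        refl = <-by-computation _ _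
x-toggle-improves-locally true  _ true  (just (switches false false)) refl = <-by-computation _ _
x-toggle-improves-locally true  _ true  (just (switches false true))  refl = <-by-computation _ _
x-toggle-improves-locally true  _ true  (just (switches true  false)) refl = <-by-computation _ _
x-toggle-improves-locally true  _ true  (just (switches true  true))  refl = <-by-computation _ _

y-toggle-improves-locally : ∀ g bx yh p → let s = switches bx yh in EnabledAt ySwitch s p →
  pairCost (hubContents g (just (toggle ySwitch s))) (sideContents (toggle ySwitch s))
    < pairCost (hubContents g (just s)) (sideContents s)
y-toggle-improves-locally false false _ _ refl = <-by-computation _ _
y-toggle-improves-locally false true  _ _ refl = <-by-computation _ _
y-toggle-improves-locally true  false _ _ refl = <-by-computation _ _
y-toggle-improves-locally true  true  _ _ refl = <-by-computation _ _

-- mover w 0 j is junk: there is no level to toggle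
mover : Switch → (L : ℕ) → ℕ → Fin (points L)
mover w       zero    j       = 0F
mover w       (suc L) (suc j) = suc (suc (suc (suc (mover w L j))))
mover xSwitch (suc L) zero    = 2F
mover ySwitch (suc L) zero    = 3F

clustering-toggleAt-other : ∀ w L (ss : Vec Switches L) j q → q ≢ mover w L j →
  clustering L (toggleAt w j ss) q ≡ clustering L ss q
clustering-toggleAt-other w       zero    []       j       0F _ = refl
clustering-toggleAt-other w       (suc L) (s ∷ ss) zero    0F _ = refl
clustering-toggleAt-other w       (suc L) (s ∷ ss) zero    1F _ = refl
clustering-toggleAt-other xSwitch (suc L) (s ∷ ss) zero    2F q≢ = ⊥-elim (q≢ refl)
clustering-toggleAt-other ySwitch (suc L) (s ∷ ss) zero    2F _ = refl
clustering-toggleAt-other xSwitch (suc L) (s ∷ ss) zero    3F _ = refl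
clustering-toggleAt-other ySwitch (suc L) (s ∷ ss) zero    3F q≢ = ⊥-elim (q≢ refl)
clustering-toggleAt-other w       (suc L) (s ∷ ss) zero    (suc (suc (suc (suc q)))) _ = refl
clustering-toggleAt-other w       (suc L) (s ∷ ss) (suc j) 0F _ = refl
clustering-toggleAt-other w       (suc L) (s ∷ ss) (suc j) 1F _ = refl
clustering-toggleAt-other w       (suc L) (s ∷ ss) (suc j) 2F _ = refl
clustering-toggleAt-other w       (suc L) (s ∷ ss) (suc j) 3F _ = refl
clustering-toggleAt-other w       (suc L) (s ∷ ss) (suc j) (suc (suc (suc (suc q)))) q≢ =
  cong (λ c → suc (suc c)) (clustering-toggleAt-other w L ss j q (q≢ ∘ cong (λ p → suc (suc (suc (suc p))))))

clustering-toggleAt-mover : ∀ w L (ss : Vec Switches L) j → j ℕ.< L →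
  clustering L (toggleAt w j ss) (mover w L j) ≢ clustering L ss (mover w L j)
clustering-toggleAt-mover xSwitch (suc L) (switches false _ ∷ ss) zero _ ()
clustering-toggleAt-mover xSwitch (suc L) (switches true  _ ∷ ss) zero _ ()
clustering-toggleAt-mover ySwitch (suc L) (switches _ false ∷ ss) zero _ ()
clustering-toggleAt-mover ySwitch (suc L) (switches _ true  ∷ ss) zero _ ()
clustering-toggleAt-mover w (suc L) (s ∷ ss) (suc j) (s≤s j<L) eq =
  clustering-toggleAt-mover w L ss j j<L (suc-injective (suc-injective eq))

hub-innerHub-cost : ∀ L g s (ss : Vec Switches L) →
  pairCost (contents (suc L) g (s ∷ ss) 0F) (contents (suc L) g (s ∷ ss) 2F)
    ≡ pairCost (hubContents g (just s)) (innerHubContents s (first ss))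
hub-innerHub-cost L g s ss = cong₂ pairCost (contents-hub (suc L) g (s ∷ ss)) (contents-innerHub L g s ss)

innerHub-hub-cost : ∀ L g s (ss : Vec Switches L) →
  pairCost (contents (suc L) g (s ∷ ss) 2F) (contents (suc L) g (s ∷ ss) 0F)
    ≡ pairCost (innerHubContents s (first ss)) (hubContents g (just s))
innerHub-hub-cost L g s ss = cong₂ pairCost (contents-innerHub L g s ss) (contents-hub (suc L) g (s ∷ ss))

hub-side-cost : ∀ L g s (ss : Vec Switches L) →
  pairCost (contents (suc L) g (s ∷ ss) 0F) (contents (suc L) g (s ∷ ss) 1F)
    ≡ pairCost (hubContents g (just s)) (sideContents s)
hub-side-cost L g s ss = cong₂ pairCost (contents-hub (suc L) g (s ∷ ss)) (contents-side L g s ss)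

side-hub-cost : ∀ L g s (ss : Vec Switches L) →
  pairCost (contents (suc L) g (s ∷ ss) 1F) (contents (suc L) g (s ∷ ss) 0F)
    ≡ pairCost (sideContents s) (hubContents g (just s))
side-hub-cost L g s ss = cong₂ pairCost (contents-side L g s ss) (contents-hub (suc L) g (s ∷ ss))

-- One level further in, everything is scaled by ratio, which multiplies costs by ratio * ratio > 0.
toggle-lowers-cost : ∀ w L g (ss : Vec Switches L) j → j ℕ.< L → Enabled w ss j →
  let old = clustering L ss (mover w L j)
      new = clustering L (toggleAt w j ss) (mover w L j)
  in pairCost (contents L g (toggleAt w j ss) old) (contents L g (toggleAt w j ss) new)
       < pairCost (contents L g ss old) (contents L g ss new)
toggle-lowers-cost xSwitch (suc L) g (switches false yh ∷ ss) zero _ enabled =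
  subst₂ _<_ (sym (hub-innerHub-cost L g (switches true yh) ss)) (sym (hub-innerHub-cost L g (switches false yh) ss))
    (x-toggle-improves-locally g false yh (first ss) enabled)
toggle-lowers-cost xSwitch (suc L) g (switches true yh ∷ ss) zero _ enabled =
  subst₂ _<_ (sym (innerHub-hub-cost L g (switches false yh) ss)) (sym (innerHub-hub-cost L g (switches true yh) ss))
    (pairCost-<-comm (hubContents g (just (switches false yh))) (innerHubContents (switches false yh) (first ss))
                     (hubContents g (just (switches true yh))) (innerHubContents (switches true yh) (first ss))
                     (x-toggle-improves-locally g true yh (first ss) enabled))
toggle-lowers-cost ySwitch (suc L) g (switches bx true ∷ ss) zero _ enabled =
  subst₂ _<_ (sym (hub-side-cost L g (switches bx false) ss)) (sym (hub-side-cost L g (switches bx true) ss))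
    (y-toggle-improves-locally g bx true (levelParity (first ss)) enabled)
toggle-lowers-cost ySwitch (suc L) g (switches bx false ∷ ss) zero _ enabled =
  subst₂ _<_ (sym (side-hub-cost L g (switches bx true) ss)) (sym (side-hub-cost L g (switches bx false) ss))
    (pairCost-<-comm (hubContents g (just (switches bx true))) (sideContents (switches bx true))
                     (hubContents g (just (switches bx false))) (sideContents (switches bx false))
                     (y-toggle-improves-locally g bx false (levelParity (first ss)) enabled))
toggle-lowers-cost w (suc L) g (s ∷ ss) (suc j) (s≤s j<L) enabled =
  subst₂ _<_ (sym (scaled (toggleAt w j ss))) (sym (scaled ss))
    (*-monoʳ-<-pos (ratio * ratio) (toggle-lowers-cost w L (xInner s) ss j j<L enabled))
  where
  old = clustering L ss (mover w L j)
  new = clustering L (toggleAt w j ss) (mover w L j)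
  scaled : ∀ ss′ →
    pairCost (contents (suc L) g (s ∷ ss′) (suc (suc old))) (contents (suc L) g (s ∷ ss′) (suc (suc new)))
      ≡ (ratio * ratio) * pairCost (contents L (xInner s) ss′ old) (contents L (xInner s) ss′ new)
  scaled ss′ = trans (cong₂ pairCost (contents-inner L g s ss′ old) (contents-inner L g s ss′ new))
                     (pairCost-scale ratio (contents L (xInner s) ss′ old) (contents L (xInner s) ss′ new))

toggle-step : ∀ w L (ss : Vec Switches L) j → j ℕ.< L → Enabled w ss j →
  HWStep (position L) (clustering L ss) (clustering L (toggleAt w j ss))
toggle-step w L ss j j<L enabled =
  hwStep-single-move (position L) (clustering L ss) (clustering L (toggleAt w j ss)) (mover w L j)
    (clustering-toggleAt-mover w L ss j j<L) (clustering-toggleAt-other w L ss j)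
    (subst₂ _<_ (cost (toggleAt w j ss)) (cost ss) (toggle-lowers-cost w L false ss j j<L enabled))
  where
  old = clustering L ss (mover w L j)
  new = clustering L (toggleAt w j ss) (mover w L j)
  cost : ∀ ss′ → pairCost (contents L false ss′ old) (contents L false ss′ new)
    ≡ clusterCost (position L) (clustering L ss′) old + clusterCost (position L) (clustering L ss′) new
  cost ss′ = sym (cong₂ _+_ (clusterCost≡listCost-contents L ss′ old)
                            (clusterCost≡listCost-contents L ss′ new))

-- The binary counter

StableAt : Switches → Bool → Set
StableAt s p = xInner s ≡ p × yHub s ≡ xInner s

Stable : ∀ {L} → Vec Switches L → ℕ → Set
Stable ss i = StableAt (at ss i) (innerParity ss i)

Ready : ∀ {L} → ℕ → Vec Switches L → Set
Ready zero    ss = ⊤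
Ready (suc j) ss = Enabled xSwitch ss j × yHub (at ss j) ≡ xInner (at ss j) × (∀ i → i ℕ.< j → Stable ss i)

counter : ∀ {L} → ℕ → Vec Switches L → Vec Switches L
counter zero    ss = ss
counter (suc j) ss = counter j (toggleAt ySwitch j (counter j (toggleAt xSwitch j ss)))

steps : ℕ → ℕ
steps zero    = 0
steps (suc j) = suc (steps j ℕ.+ suc (steps j))

y-enabled-after-x : ∀ s p → yHub s ≡ xInner s → EnabledAt ySwitch (toggle xSwitch s) p
y-enabled-after-x (switches bx _) p refl = sym (not-involutive bx)

stable-after-x-and-y : ∀ s p → EnabledAt xSwitch s p → yHub s ≡ xInner s →
  StableAt (toggle ySwitch (toggle xSwitch s)) p
stable-after-x-and-y (switches _ _) p refl refl = not-involutive p , refl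

parity-toggle : ∀ w s → parity (toggle w s) ≡ not (parity s)
parity-toggle xSwitch (switches bx yh) = sym (not-distribˡ-xor bx yh)
parity-toggle ySwitch (switches bx yh) = sym (not-distribʳ-xor bx yh)

at-toggleAt-same : ∀ {L} w (ss : Vec Switches L) j → j ℕ.< L → at (toggleAt w j ss) j ≡ toggle w (at ss j)
at-toggleAt-same w (s ∷ ss) zero    _         = refl
at-toggleAt-same w (s ∷ ss) (suc j) (s≤s j<L) = at-toggleAt-same w ss j j<L

at-toggleAt-other : ∀ {L} w (ss : Vec Switches L) j i → i ≢ j → at (toggleAt w j ss) i ≡ at ss i
at-toggleAt-other w []       j       i       _   = refl
at-toggleAt-other w (s ∷ ss) zero    zero    i≢j = ⊥-elim (i≢j refl)
at-toggleAt-other w (s ∷ ss) zero    (suc i) _   = refl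
at-toggleAt-other w (s ∷ ss) (suc j) zero    _   = refl
at-toggleAt-other w (s ∷ ss) (suc j) (suc i) i≢j = at-toggleAt-other w ss j i (i≢j ∘ cong suc)

innerParity-cong : ∀ {L} (ss ss′ : Vec Switches L) i →
  at ss (suc i) ≡ at ss′ (suc i) → innerParity ss i ≡ innerParity ss′ i
innerParity-cong []           []             i       _ = refl
innerParity-cong (_ ∷ [])     (_ ∷ [])       zero    _ = refl
innerParity-cong (_ ∷ t ∷ ss) (_ ∷ t′ ∷ ss′) zero    e = cong parity e
innerParity-cong (_ ∷ ss)     (_ ∷ ss′)      (suc i) e = innerParity-cong ss ss′ i e

innerParity-toggleAt : ∀ {L} w (ss : Vec Switches L) j → suc j ℕ.< L →
  innerParity (toggleAt w (suc j) ss) j ≡ not (innerParity ss j)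
innerParity-toggleAt w (s ∷ [])     zero    (s≤s ())
innerParity-toggleAt w (s ∷ t ∷ ss) zero    _          = parity-toggle w t
innerParity-toggleAt w (s ∷ ss)     (suc j) (s≤s j<L) = innerParity-toggleAt w ss j j<L

Stable-cong : ∀ {L} (ss ss′ : Vec Switches L) i →
  at ss i ≡ at ss′ i → at ss (suc i) ≡ at ss′ (suc i) → Stable ss i → Stable ss′ i
Stable-cong ss ss′ i same same-below = subst₂ StableAt same (innerParity-cong ss ss′ i same-below)

-- Toggling level j flips the parity seen by level j - 1, which was stable and so becomes ready.
ready-after-toggle : ∀ {L} w (ss : Vec Switches L) j → j ℕ.< L →
  (∀ i → i ℕ.< j → Stable ss i) → Ready j (toggleAt w j ss)
ready-after-toggle w ss zero    _   _      = tt
ready-after-toggle w ss (suc j) j<L stable = enabled , aligned , stable′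
  where
  open ≡-Reasoning
  ss′ = toggleAt w (suc j) ss
  same : at ss′ j ≡ at ss j
  same = at-toggleAt-other w ss (suc j) j (ℕ.<⇒≢ (ℕ.n<1+n j))
  x≡p : xInner (at ss j) ≡ innerParity ss j
  x≡p = proj₁ (stable j (ℕ.n<1+n j))
  enabled : xInner (at ss′ j) ≡ not (innerParity ss′ j)
  enabled = begin
    xInner (at ss′ j)              ≡⟨ cong xInner same ⟩
    xInner (at ss j)               ≡⟨ x≡p ⟩
    innerParity ss j               ≡⟨ not-involutive _ ⟨
    not (not (innerParity ss j))   ≡⟨ cong not (innerParity-toggleAt w ss j j<L) ⟨
    not (innerParity ss′ j)        ∎
  aligned : yHub (at ss′ j) ≡ xInner (at ss′ j)
  aligned = subst (λ s → yHub s ≡ xInner s) (sym same) (proj₂ (stable j (ℕ.n<1+n j)))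
  stable′ : ∀ i → i ℕ.< j → Stable ss′ i
  stable′ i i<j = Stable-cong ss ss′ i
    (sym (at-toggleAt-other w ss (suc j) i (ℕ.<⇒≢ (ℕ.m<n⇒m<1+n i<j))))
    (sym (at-toggleAt-other w ss (suc j) (suc i) (ℕ.<⇒≢ (s≤s i<j))))
    (stable i (ℕ.m<n⇒m<1+n i<j))

run-counter : ∀ {L} j (ss : Vec Switches L) → j ℕ.≤ L → Ready j ss →
  Execution (position L) (clustering L ss) (clustering L (counter j ss)) (steps j)
    × (∀ i → i ℕ.< j → Stable (counter j ss) i)
    × (∀ i → j ℕ.≤ i → at (counter j ss) i ≡ at ss i)
run-counter zero ss _ _ = [] , (λ _ ()) , (λ _ _ → refl)
run-counter {L} (suc j) ss j<L (x-enabled , aligned , stable) =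
  toggle-step xSwitch L ss j j<L x-enabled ∷ (run₁ ++ₑ (toggle-step ySwitch L ss₂ j j<L y-enabled ∷ run₃)) ,
  stable-final , unchanged
  where
  open ≡-Reasoning
  ss₁ = toggleAt xSwitch j ss
  counted₁ = run-counter j ss₁ (ℕ.<⇒≤ j<L) (ready-after-toggle xSwitch ss j j<L stable)
  run₁       = proj₁ counted₁
  stable₁    = proj₁ (proj₂ counted₁)
  unchanged₁ = proj₂ (proj₂ counted₁)
  ss₂ = counter j ss₁
  at₂ : at ss₂ j ≡ toggle xSwitch (at ss j)
  at₂ = trans (unchanged₁ j ℕ.≤-refl) (at-toggleAt-same xSwitch ss j j<L)
  y-enabled : Enabled ySwitch ss₂ j
  y-enabled = subst (λ s → EnabledAt ySwitch s (innerParity ss₂ j)) (sym at₂)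
                (y-enabled-after-x (at ss j) (innerParity ss₂ j) aligned)
  ss₃ = toggleAt ySwitch j ss₂
  counted₃ = run-counter j ss₃ (ℕ.<⇒≤ j<L) (ready-after-toggle ySwitch ss₂ j j<L stable₁)
  run₃       = proj₁ counted₃
  stable₃    = proj₁ (proj₂ counted₃)
  unchanged₃ = proj₂ (proj₂ counted₃)
  final = counter j ss₃
  unchanged-from : ∀ i → j ℕ.≤ i → i ≢ j → at final i ≡ at ss i
  unchanged-from i j≤i i≢j = begin
    at final i   ≡⟨ unchanged₃ i j≤i ⟩
    at ss₃ i     ≡⟨ at-toggleAt-other ySwitch ss₂ j i i≢j ⟩
    at ss₂ i     ≡⟨ unchanged₁ i j≤i ⟩
    at ss₁ i     ≡⟨ at-toggleAt-other xSwitch ss j i i≢j ⟩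
    at ss i      ∎
  unchanged : ∀ i → suc j ℕ.≤ i → at final i ≡ at ss i
  unchanged i j<i = unchanged-from i (ℕ.<⇒≤ j<i) (ℕ.>⇒≢ j<i)
  at-final : at final j ≡ toggle ySwitch (toggle xSwitch (at ss j))
  at-final = begin
    at final j                 ≡⟨ unchanged₃ j ℕ.≤-refl ⟩
    at ss₃ j                   ≡⟨ at-toggleAt-same ySwitch ss₂ j j<L ⟩
    toggle ySwitch (at ss₂ j)  ≡⟨ cong (toggle ySwitch) at₂ ⟩
    toggle ySwitch (toggle xSwitch (at ss j)) ∎
  stable-final : ∀ i → i ℕ.< suc j → Stable final i
  stable-final i i<1+j with ℕ.m<1+n⇒m<n∨m≡n i<1+j
  ... | inj₁ i<j  = stable₃ i i<j
  ... | inj₂ refl =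
    subst₂ StableAt (sym at-final) (innerParity-cong ss final j (sym (unchanged (suc j) ℕ.≤-refl)))
      (stable-after-x-and-y (at ss j) (innerParity ss j) x-enabled aligned)

initial : (L : ℕ) → Vec Switches L
initial L = replicate L (switches false false)

at-initial : ∀ L i → at (initial L) i ≡ switches false false
at-initial zero    i       = refl
at-initial (suc L) zero    = refl
at-initial (suc L) (suc i) = at-initial L i

innerParity-initial : ∀ L i → suc i ℕ.< L → innerParity (initial L) i ≡ false
innerParity-initial (suc (suc L)) zero    _         = refl
innerParity-initial (suc L)       (suc i) (s≤s i<L) = innerParity-initial L i i<L

innerParity-initial-innermost : ∀ L → innerParity (initial (suc L)) L ≡ true
innerParity-initial-innermost zero    = refl
innerParity-initial-innermost (suc L) = innerParity-initial-innermost L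

ready-initial : ∀ L → Ready L (initial L)
ready-initial zero    = tt
ready-initial (suc L) =
  trans (cong xInner (at-initial (suc L) L)) (cong not (sym (innerParity-initial-innermost L))) ,
  trans (cong yHub (at-initial (suc L) L)) (sym (cong xInner (at-initial (suc L) L))) ,
  λ i i<L → trans (cong xInner (at-initial (suc L) i)) (sym (innerParity-initial (suc L) i (s≤s i<L))) ,
            trans (cong yHub (at-initial (suc L) i)) (sym (cong xInner (at-initial (suc L) i)))

clustering-nonempty : ∀ L (ss : Vec Switches L) → Nonempty (clustering L ss)
clustering-nonempty zero    []       0F = 0F , refl
clustering-nonempty (suc L) (s ∷ ss) 0F = 0F , refl
clustering-nonempty (suc L) (s ∷ ss) 1F = 1F , refl
clustering-nonempty (suc L) (s ∷ ss) (suc (suc c)) with clustering-nonempty L ss c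
... | p , e = suc (suc (suc (suc p))) , cong (λ c → suc (suc c)) e

-- Distinct points

sq-* : ∀ r w → sq (r * w) ≡ (r * r) * sq w
sq-* = solve 2 (λ r w → (r :* w) :* (r :* w) := (r :* r) :* (w :* w)) refl
  where open +-*-Solver

ratio*-injective : ∀ {p q} → ratio * p ≡ ratio * q → p ≡ q
ratio*-injective e =
  ≤-antisym (*-cancelˡ-≤-neg ratio (≤-reflexive (sym e))) (*-cancelˡ-≤-neg ratio (≤-reflexive e))

ratio²≤sq-inner : ∀ L p → ratio * ratio ≤ sq (ratio * position L p)
ratio²≤sq-inner L p = subst (ratio * ratio ≤_) (sym (sq-* ratio (position L p)))
  (subst (_≤ (ratio * ratio) * sq (position L p)) (*-identityʳ (ratio * ratio))
    (*-monoˡ-≤-nonNeg (ratio * ratio) (1≤sq-position L p)))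
  where
  1≤sq-position : ∀ L p → 1ℚ ≤ sq (position L p)
  1≤sq-position zero    0F = ≤-by-computation _ _
  1≤sq-position (suc L) 0F = ≤-by-computation _ _
  1≤sq-position (suc L) 1F = ≤-by-computation _ _
  1≤sq-position (suc L) 2F = ≤-by-computation _ _
  1≤sq-position (suc L) 3F = ≤-by-computation _ _
  1≤sq-position (suc L) (suc (suc (suc (suc p)))) =
    ≤-trans (≤-by-computation 1ℚ (ratio * ratio)) (ratio²≤sq-inner L p)

outer≢inner : ∀ {u} → sq u < ratio * ratio → ∀ L p → u ≢ ratio * position L p
outer≢inner small L p refl = <-irrefl refl (<-≤-trans small (ratio²≤sq-inner L p))

position-injective : ∀ L → Injective _≡_ _≡_ (position L)
position-injective zero    {0F} {0F} _ = refl
position-injective (suc L) {suc (suc (suc (suc p)))} {suc (suc (suc (suc q)))} e =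
  cong (λ p → suc (suc (suc (suc p)))) (position-injective L (ratio*-injective e))
position-injective (suc L) {0F} {0F} _ = refl
position-injective (suc L) {1F} {1F} _ = refl
position-injective (suc L) {2F} {2F} _ = refl
position-injective (suc L) {3F} {3F} _ = refl
position-injective (suc L) {0F} {1F} ()
position-injective (suc L) {0F} {2F} ()
position-injective (suc L) {0F} {3F} ()
position-injective (suc L) {1F} {0F} ()
position-injective (suc L) {1F} {2F} ()
position-injective (suc L) {1F} {3F} ()
position-injective (suc L) {2F} {0F} ()
position-injective (suc L) {2F} {1F} ()
position-injective (suc L) {2F} {3F} ()
position-injective (suc L) {3F} {0F} ()
position-injective (suc L) {3F} {1F} ()
position-injective (suc L) {3F} {2F} ()
position-injective (suc L) {0F} {suc (suc (suc (suc q)))} e = ⊥-elim (outer≢inner (<-by-computation _ _) L q e)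
position-injective (suc L) {1F} {suc (suc (suc (suc q)))} e = ⊥-elim (outer≢inner (<-by-computation _ _) L q e)
position-injective (suc L) {2F} {suc (suc (suc (suc q)))} e = ⊥-elim (outer≢inner (<-by-computation _ _) L q e)
position-injective (suc L) {3F} {suc (suc (suc (suc q)))} e = ⊥-elim (outer≢inner (<-by-computation _ _) L q e)
position-injective (suc L) {suc (suc (suc (suc p)))} {0F} e = ⊥-elim (outer≢inner (<-by-computation _ _) L p (sym e))
position-injective (suc L) {suc (suc (suc (suc p)))} {1F} e = ⊥-elim (outer≢inner (<-by-computation _ _) L p (sym e))
position-injective (suc L) {suc (suc (suc (suc p)))} {2F} e = ⊥-elim (outer≢inner (<-by-computation _ _) L p (sym e))
position-injective (suc L) {suc (suc (suc (suc p)))} {3F} e = ⊥-elim (outer≢inner (<-by-computation _ _) L p (sym e))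

-- The exponential bound

steps-≥ : ∀ j → 2 ^ suc j ℕ.≤ steps (suc j)
steps-≥ zero    = ℕ.≤-refl
steps-≥ (suc j) = begin
  2 ^ suc j ℕ.+ (2 ^ suc j ℕ.+ 0)   ≤⟨ ℕ.+-mono-≤ (steps-≥ j) (ℕ.+-mono-≤ (steps-≥ j) z≤n) ⟩
  s ℕ.+ (s ℕ.+ 0)                   ≡⟨ cong (s ℕ.+_) (ℕ.+-identityʳ s) ⟩
  s ℕ.+ s                           ≤⟨ ℕ.+-monoʳ-≤ s (ℕ.n≤1+n s) ⟩
  s ℕ.+ suc s                       ≤⟨ ℕ.n≤1+n _ ⟩
  steps (suc (suc j))               ∎
  where
  open ℕ.≤-Reasoning
  s = steps (suc j)

exponential-bound : ∀ L T → steps (suc L) ℕ.≤ T → 2 ^ (1 ℕ.* points (suc L)) ℕ.≤ T ^ 5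
exponential-bound L T steps≤T = begin
  2 ^ (1 ℕ.* points (suc L))  ≡⟨ cong (2 ^_) (ℕ.*-identityˡ (points (suc L))) ⟩
  2 ^ points (suc L)          ≤⟨ ℕ.^-monoʳ-≤ 2 (ℕ.+-monoʳ-≤ 5 (ℕ.*-monoʳ-≤ L (ℕ.n≤1+n 4))) ⟩
  2 ^ (suc L ℕ.* 5)           ≡⟨ ℕ.^-*-assoc 2 (suc L) 5 ⟨
  (2 ^ suc L) ^ 5             ≤⟨ ℕ.^-monoˡ-≤ 5 (ℕ.≤-trans (steps-≥ L) steps≤T) ⟩
  T ^ 5                       ∎
  where open ℕ.≤-Reasoning

SlowInstance : ℕ → ℕ → Set
SlowInstance n k =
  Σ (Fin n → ℚ) λ X → Injective _≡_ _≡_ X ×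
  Σ ℕ λ T → Σ (ℕ → Clustering n k) λ run →
    Nonempty (run 0) ×
    (∀ t → t ℕ.< T → HWStep X (run t) (run (suc t))) ×
    LocalOpt X (run T) ×
    (2 ^ (1 ℕ.* n) ℕ.≤ T ^ 5)

slowInstance : ∀ L → SlowInstance (points (suc L)) (clusters (suc L))
slowInstance L =
  X , position-injective (suc L) , steps (suc L) ℕ.+ T′ , run ,
  subst Nonempty (sym starts) (clustering-nonempty (suc L) (initial (suc L))) , hw-steps ,
  subst (LocalOpt X) (sym ends) optimal , exponential-bound L _ (ℕ.m≤m+n (steps (suc L)) T′)
  where
  X = position (suc L)
  start counted : Clustering (points (suc L)) (clusters (suc L))
  start   = clustering (suc L) (initial (suc L))
  counted = clustering (suc L) (counter (suc L) (initial (suc L)))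
  counting : Execution X start counted (steps (suc L))
  counting = proj₁ (run-counter (suc L) (initial (suc L)) ℕ.≤-refl (ready-initial (suc L)))
  terminated : ∃ λ T′ → ∃ λ c → Execution X counted c T′ × LocalOpt X c
  terminated = hartiganWong-terminates X counted
  T′ = proj₁ terminated
  optimum = proj₁ (proj₂ terminated)
  optimal : LocalOpt X optimum
  optimal = proj₂ (proj₂ (proj₂ terminated))
  whole : Σ (ℕ → Clustering (points (suc L)) (clusters (suc L))) λ run →
    run 0 ≡ start × run (steps (suc L) ℕ.+ T′) ≡ optimum ×
    (∀ t → t ℕ.< steps (suc L) ℕ.+ T′ → HWStep X (run t) (run (suc t)))
  whole = execution⇒run (counting ++ₑ proj₁ (proj₂ (proj₂ terminated)))
  run = proj₁ whole
  starts = proj₁ (proj₂ whole)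
  ends = proj₁ (proj₂ (proj₂ whole))
  hw-steps = proj₂ (proj₂ (proj₂ whole))

points-≡ : ∀ L → points (suc L) ≡ 4 ℕ.* suc (suc L) ∸ 3
points-≡ L = trans (cong suc (ℕ.*-comm (suc L) 4)) (sym (cong (_∸ 3) (ℕ.*-suc 4 (suc L))))

clusters-≡ : ∀ L → clusters (suc L) ≡ 2 ℕ.* suc (suc L) ∸ 1
clusters-≡ L = trans (cong suc (ℕ.*-comm (suc L) 2)) (sym (cong (_∸ 1) (ℕ.*-suc 2 (suc L))))

theorem1 : Σ ℕ λ p → Σ ℕ λ q → (0 ℕ.< p) × (0 ℕ.< q) ×
    ((m : ℕ) → 2 ℕ.≤ m →
      Σ (Fin (4 ℕ.* m ∸ 3) → ℚ) λ X → Injective _≡_ _≡_ X ×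
      Σ ℕ λ T → Σ (ℕ → Clustering (4 ℕ.* m ∸ 3) (2 ℕ.* m ∸ 1)) λ run →
        Nonempty (run 0) ×
        (∀ t → t ℕ.< T → HWStep X (run t) (run (suc t))) ×
        LocalOpt X (run T) ×
        (2 ^ (p ℕ.* (4 ℕ.* m ∸ 3)) ℕ.≤ T ^ q))
theorem1 = 1 , 5 , s≤s z≤n , s≤s z≤n , λ where
  (suc (suc L)) _         → subst₂ SlowInstance (points-≡ L) (clusters-≡ L) (slowInstance L)
  (suc zero)    (s≤s ())
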